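{- Let $p>2$ be a prime. Then $P(p,3)=\mathrm{lcm}(O(p),6)$.
   Context: $O(p)$ denotes the multiplicative order of $2$ modulo $p$. For positive integers $m,n$, let $\mathbf{Z}_m$ be the ring of integers modulo $m$ and define $T:\mathbf{Z}_m^n\to\mathbf{Z}_m^n$ by $T(a_0,\dots,a_{n-1})=(a_0+a_1,a_1+a_2,\dots,a_{n-2}+a_{n-1},a_{n-1}+a_0)$. For $\mathbf{a}\in\mathbf{Z}_m^n$, the cycle length of $(T^k\mathbf{a})_{k\ge0}$ is the smallest positive integer $P$ for which there exists $N$ with $T^{k+P}\mathbf{a}=T^k\mathbf{a}$ for all $k\ge N$. The period $P(m,n)$ is the maximum of these cycle lengths over all $\mathbf{a}\in\mathbf{Z}_m^n$. -}

module Defs where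

open import Data.Nat using (ℕ; zero; suc; _+_; _*_; _^_; _≤_; _<_; NonZero)
open import Data.Nat.DivMod using (_%_)
open import Data.Fin using (Fin; toℕ; fromℕ<)
open import Data.Fin.Properties using ()
open import Data.Nat.DivMod using (m%n<n)
open import Data.Vec using (Vec; []; _∷_; zipWith; _∷ʳ_)
open import Data.Product using (Σ; _×_; ∃; ∃-syntax)
open import Relation.Binary.PropositionalEquality using (_≡_)

_+ₘ_ : ∀ {m} .{{_ : NonZero m}} → Fin m → Fin m → Fin m
_+ₘ_ {m} a b = fromℕ< (m%n<n (toℕ a + toℕ b) m)

rotate : ∀ {A : Set} {n} → Vec A n → Vec A n
rotate []       = []
rotate (x ∷ xs) = xs ∷ʳ x

T : ∀ {m n} .{{_ : NonZero m}} → Vec (Fin m) n → Vec (Fin m) n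
T a = zipWith _+ₘ_ a (rotate a)

T^ : ∀ {m n} .{{_ : NonZero m}} → ℕ → Vec (Fin m) n → Vec (Fin m) n
T^ zero    a = a
T^ (suc k) a = T (T^ k a)

EventuallyPeriodic : ∀ {m n} .{{_ : NonZero m}} → Vec (Fin m) n → ℕ → Set
EventuallyPeriodic a P = ∃[ N ] (∀ k → N ≤ k → T^ (k + P) a ≡ T^ k a)

IsCycleLength : ∀ {m n} .{{_ : NonZero m}} → Vec (Fin m) n → ℕ → Set
IsCycleLength a P =
  0 < P × EventuallyPeriodic a P × (∀ Q → 0 < Q → EventuallyPeriodic a Q → P ≤ Q)

IsPeriod : (m n : ℕ) .{{_ : NonZero m}} → ℕ → Set
IsPeriod m n P =
  (∃[ a ] IsCycleLength {m} {n} a P) ×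
  (∀ (a : Vec (Fin m) n) Q → IsCycleLength a Q → Q ≤ P)

IsOrderOf2 : (p : ℕ) .{{_ : NonZero p}} → ℕ → Set
IsOrderOf2 p O =
  0 < O × (2 ^ O) % p ≡ 1 % p × (∀ k → 0 < k → (2 ^ k) % p ≡ 1 % p → O ≤ k)

-- Over ℕ, T⁶ = I + 21 J with J the all-ones 3 × 3 matrix, and J² = 3 J, so T⁶ᵏ = I + c J with
-- 3 c + 1 = 2⁶ᵏ and 3 ∣ c. For 6k = lcm(O, 6) we get 2⁶ᵏ ≡ 1, so p ∣ 3 c, hence p ∣ c (if p = 3
-- use 3 ∣ c), and T^lcm(O,6) is the identity mod p. Conversely, if T^Q fixes e₁ = (1,0,0) mod p,
-- write Q = 6 q + r: then T^r e₁ + d (1,1,1) ≡ e₁ for some d, which for r < 6 forces r = 0 and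
-- c ≡ 0, hence 2^Q = 3 c + 1 ≡ 1. So both O and 6 divide Q.
module Submission where

open import Defs
open import Data.Nat using (ℕ; _<_; NonZero)
open import Data.Nat.Primality using (Prime)
open import Data.Nat.LCM using (lcm)

open import Data.Nat using (zero; suc; _+_; _*_; _^_; _≤_; pred; z<s; s≤s; >-nonZero; >-nonZero⁻¹)
open import Data.Nat.Properties
open import Data.Nat.DivMod using (_%_; _/_; _mod_; m%n<n; m<n⇒m%n≡m; m*n%n≡0; %-distribˡ-+; %-distribˡ-*; [m+kn]%n≡m%n; m≡m%n+[m/n]*n)
open import Data.Nat.Divisibility
open import Data.Nat.Primality using (euclidsLemma)
open import Data.Nat.LCM using (lcm-least; m∣lcm[m,n]; n∣lcm[m,n]; gcd*lcm)
open import Data.Nat.GCD using (gcd)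
open import Data.Nat.Tactic.RingSolver using (solve-∀)
open import Data.Fin using (Fin; toℕ; #_)
open import Data.Fin.Properties using (toℕ-fromℕ<; toℕ-injective; toℕ<n)
open import Data.Vec using (Vec; []; _∷_; _∷ʳ_; map; zipWith; sum; lookup)
open import Data.Vec.Properties using (map-∷ʳ; map-∘; map-cong; map-id; lookup-map)
open import Data.Product using (_×_; _,_; proj₁; proj₂)
open import Data.Sum using (inj₁; inj₂)
open import Data.Empty using (⊥-elim)
open import Function using (_∘_)
open import Algebra.Properties.CommutativeSemigroup +-commutativeSemigroup using (x∙yz≈y∙xz)
open import Relation.Nullary using (¬_)
open import Relation.Binary.PropositionalEquality

private
  variable
    A B : Set
    n : ℕ

map-rotate : ∀ (f : A → B) (v : Vec A n) → map f (rotate v) ≡ rotate (map f v)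
map-rotate f []       = refl
map-rotate f (x ∷ xs) = map-∷ʳ f x xs

zipWith-map-hom : ∀ {f g : A → B} {_⊕_ : B → B → B} {_⊗_ : A → A → A} →
  (∀ x y → f x ⊕ f y ≡ g (x ⊗ y)) →
  ∀ (xs ys : Vec A n) → zipWith _⊕_ (map f xs) (map f ys) ≡ map g (zipWith _⊗_ xs ys)
zipWith-map-hom hom []       []       = refl
zipWith-map-hom hom (x ∷ xs) (y ∷ ys) = cong₂ _∷_ (hom x y) (zipWith-map-hom hom xs ys)

zipWith-rotate-map : ∀ {f g : A → B} {_⊕_ : B → B → B} {_⊗_ : A → A → A} →
  (∀ x y → f x ⊕ f y ≡ g (x ⊗ y)) →
  ∀ (v : Vec A n) → zipWith _⊕_ (map f v) (rotate (map f v)) ≡ map g (zipWith _⊗_ v (rotate v))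
zipWith-rotate-map {f = f} {_⊕_ = _⊕_} hom v =
  trans (cong (zipWith _⊕_ (map f v)) (sym (map-rotate f v))) (zipWith-map-hom hom v (rotate v))

sum-∷ʳ : ∀ (xs : Vec ℕ n) x → sum (xs ∷ʳ x) ≡ sum xs + x
sum-∷ʳ []       x = +-identityʳ x
sum-∷ʳ (y ∷ xs) x = trans (cong (y +_) (sum-∷ʳ xs x)) (sym (+-assoc y (sum xs) x))

sum-rotate : ∀ (v : Vec ℕ n) → sum (rotate v) ≡ sum v
sum-rotate []       = refl
sum-rotate (x ∷ xs) = trans (sum-∷ʳ xs x) (+-comm (sum xs) x)

Tℕ : Vec ℕ n → Vec ℕ n
Tℕ v = zipWith _+_ v (rotate v)

Tℕ^ : ℕ → Vec ℕ n → Vec ℕ n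
Tℕ^ zero    v = v
Tℕ^ (suc k) v = Tℕ (Tℕ^ k v)

Tℕ^-+ : ∀ i j (v : Vec ℕ n) → Tℕ^ (i + j) v ≡ Tℕ^ i (Tℕ^ j v)
Tℕ^-+ zero    j v = refl
Tℕ^-+ (suc i) j v = cong Tℕ (Tℕ^-+ i j v)

shift : ℕ → Vec ℕ n → Vec ℕ n
shift d = map (_+ d)

shift-shift : ∀ d e (v : Vec ℕ n) → shift e (shift d v) ≡ shift (d + e) v
shift-shift d e v = trans (sym (map-∘ (_+ e) (_+ d) v)) (map-cong (λ x → +-assoc x d e) v)

Tℕ-shift : ∀ d (v : Vec ℕ n) → Tℕ (shift d v) ≡ shift (2 * d) (Tℕ v)
Tℕ-shift d = zipWith-rotate-map (λ x y → shifted-sum x y d)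
  where
  shifted-sum : ∀ x y d → (x + d) + (y + d) ≡ (x + y) + 2 * d
  shifted-sum = solve-∀

Tℕ^-shift : ∀ k d (v : Vec ℕ n) → Tℕ^ k (shift d v) ≡ shift (2 ^ k * d) (Tℕ^ k v)
Tℕ^-shift zero    d v = cong (λ e → shift e v) (sym (*-identityˡ d))
Tℕ^-shift (suc k) d v = begin
  Tℕ (Tℕ^ k (shift d v))                ≡⟨ cong Tℕ (Tℕ^-shift k d v) ⟩
  Tℕ (shift (2 ^ k * d) (Tℕ^ k v))      ≡⟨ Tℕ-shift (2 ^ k * d) (Tℕ^ k v) ⟩
  shift (2 * (2 ^ k * d)) (Tℕ^ (suc k) v) ≡⟨ cong (λ e → shift e (Tℕ^ (suc k) v)) (*-assoc 2 (2 ^ k) d) ⟨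
  shift (2 ^ suc k * d) (Tℕ^ (suc k) v)   ∎
  where open ≡-Reasoning

Tℕ² : ∀ (v : Vec ℕ 3) → Tℕ^ 2 v ≡ shift (sum v) (rotate v)
Tℕ² (x ∷ y ∷ z ∷ []) =
  cong₂ _∷_ (entry₁ x y z) (cong₂ _∷_ (entry₂ x y z) (cong (_∷ []) (entry₃ x y z)))
  where
  entry₁ : ∀ x y z → (x + y) + (y + z) ≡ y + (x + (y + (z + 0)))
  entry₂ : ∀ x y z → (y + z) + (z + x) ≡ z + (x + (y + (z + 0)))
  entry₃ : ∀ x y z → (z + x) + (x + y) ≡ x + (x + (y + (z + 0)))
  entry₁ = solve-∀
  entry₂ = solve-∀
  entry₃ = solve-∀

Tℕ⁶ : ∀ (v : Vec ℕ 3) → Tℕ^ 6 v ≡ shift (21 * sum v) v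
Tℕ⁶ v@(_ ∷ _ ∷ _ ∷ []) = begin
  Tℕ^ 4 (Tℕ^ 2 v)                                         ≡⟨ cong (Tℕ^ 4) (Tℕ² v) ⟩
  Tℕ^ 4 (shift s (rotate v))                              ≡⟨ Tℕ^-shift 4 s (rotate v) ⟩
  shift (16 * s) (Tℕ^ 2 (Tℕ^ 2 (rotate v)))               ≡⟨ cong (shift (16 * s) ∘ Tℕ^ 2) (Tℕ² (rotate v)) ⟩
  shift (16 * s) (Tℕ^ 2 (shift s₁ (rotate (rotate v))))   ≡⟨ cong (shift (16 * s)) (Tℕ^-shift 2 s₁ (rotate (rotate v))) ⟩
  shift (16 * s) (shift (4 * s₁) (Tℕ^ 2 (rotate (rotate v))))
                                                          ≡⟨ cong (shift (16 * s) ∘ shift (4 * s₁)) (Tℕ² (rotate (rotate v))) ⟩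
  shift (16 * s) (shift (4 * s₁) (shift s₂ v))            ≡⟨ cong (shift (16 * s)) (shift-shift s₂ (4 * s₁) v) ⟩
  shift (16 * s) (shift (s₂ + 4 * s₁) v)                  ≡⟨ shift-shift (s₂ + 4 * s₁) (16 * s) v ⟩
  shift (s₂ + 4 * s₁ + 16 * s) v                          ≡⟨ cong (λ e → shift e v) coefficient ⟩
  shift (21 * s) v                                        ∎
  where
  open ≡-Reasoning
  s s₁ s₂ : ℕ
  s  = sum v
  s₁ = sum (rotate v)
  s₂ = sum (rotate (rotate v))
  collect : ∀ s → s + 4 * s + 16 * s ≡ 21 * s
  collect = solve-∀
  coefficient : s₂ + 4 * s₁ + 16 * s ≡ 21 * s
  coefficient = trans (cong₂ (λ a b → a + 4 * b + 16 * s) (trans (sum-rotate (rotate v)) (sum-rotate v)) (sum-rotate v))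
                      (collect s)

jCoeff : ℕ → ℕ
jCoeff zero    = 0
jCoeff (suc k) = 21 + 64 * jCoeff k

Tℕ^6k : ∀ k (v : Vec ℕ 3) → Tℕ^ (6 * k) v ≡ shift (jCoeff k * sum v) v
Tℕ^6k zero    v = sym (trans (map-cong +-identityʳ v) (map-id v))
Tℕ^6k (suc k) v = begin
  Tℕ^ (6 * suc k) v                        ≡⟨ cong (λ i → Tℕ^ i v) (*-suc 6 k) ⟩
  Tℕ^ (6 + 6 * k) v                        ≡⟨ Tℕ^-+ 6 (6 * k) v ⟩
  Tℕ^ 6 (Tℕ^ (6 * k) v)                    ≡⟨ cong (Tℕ^ 6) (Tℕ^6k k v) ⟩
  Tℕ^ 6 (shift (c * s) v)                  ≡⟨ Tℕ^-shift 6 (c * s) v ⟩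
  shift (64 * (c * s)) (Tℕ^ 6 v)           ≡⟨ cong (shift (64 * (c * s))) (Tℕ⁶ v) ⟩
  shift (64 * (c * s)) (shift (21 * s) v)  ≡⟨ shift-shift (21 * s) (64 * (c * s)) v ⟩
  shift (21 * s + 64 * (c * s)) v          ≡⟨ cong (λ e → shift e v) (recurrence c s) ⟩
  shift (jCoeff (suc k) * s) v             ∎
  where
  open ≡-Reasoning
  c s : ℕ
  c = jCoeff k
  s = sum v
  recurrence : ∀ c s → 21 * s + 64 * (c * s) ≡ (21 + 64 * c) * s
  recurrence = solve-∀

Tℕ^[r+6q] : ∀ r q (v : Vec ℕ 3) → Tℕ^ (r + 6 * q) v ≡ shift (2 ^ r * (jCoeff q * sum v)) (Tℕ^ r v)
Tℕ^[r+6q] r q v = begin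
  Tℕ^ (r + 6 * q) v                   ≡⟨ Tℕ^-+ r (6 * q) v ⟩
  Tℕ^ r (Tℕ^ (6 * q) v)               ≡⟨ cong (Tℕ^ r) (Tℕ^6k q v) ⟩
  Tℕ^ r (shift (jCoeff q * sum v) v)  ≡⟨ Tℕ^-shift r (jCoeff q * sum v) v ⟩
  shift (2 ^ r * (jCoeff q * sum v)) (Tℕ^ r v) ∎
  where open ≡-Reasoning

3*jCoeff+1≡2^6k : ∀ k → 3 * jCoeff k + 1 ≡ 2 ^ (6 * k)
3*jCoeff+1≡2^6k k = trans (3*jCoeff+1≡64^ k) (^-*-assoc 2 6 k)
  where
  step : ∀ c → 3 * (21 + 64 * c) + 1 ≡ 64 * (3 * c + 1)
  step = solve-∀
  3*jCoeff+1≡64^ : ∀ k → 3 * jCoeff k + 1 ≡ 64 ^ k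
  3*jCoeff+1≡64^ zero    = refl
  3*jCoeff+1≡64^ (suc k) = trans (step (jCoeff k)) (cong (64 *_) (3*jCoeff+1≡64^ k))

3∣jCoeff : ∀ k → 3 ∣ jCoeff k
3∣jCoeff zero    = 3 ∣0
3∣jCoeff (suc k) = ∣m∣n⇒∣m+n (divides 7 refl) (∣n⇒∣m*n 64 (3∣jCoeff k))

module _ {m : ℕ} .{{_ : NonZero m}} where

  T^-+ : ∀ i j (a : Vec (Fin m) n) → T^ (i + j) a ≡ T^ i (T^ j a)
  T^-+ zero    j a = refl
  T^-+ (suc i) j a = cong T (T^-+ i j a)

  T^-*-fixed : ∀ {L} {a : Vec (Fin m) n} → T^ L a ≡ a → ∀ N → T^ (N * L) a ≡ a
  T^-*-fixed         fixed zero    = refl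
  T^-*-fixed {L = L} {a = a} fixed (suc N) =
    trans (T^-+ L (N * L) a) (trans (cong (T^ L) (T^-*-fixed fixed N)) fixed)

  fixed⇒eventuallyPeriodic : ∀ {L} {a : Vec (Fin m) n} → T^ L a ≡ a → EventuallyPeriodic a L
  fixed⇒eventuallyPeriodic {L = L} {a = a} fixed = 0 , λ k _ → trans (T^-+ k L a) (cong (T^ k) fixed)

  fixed∧eventuallyPeriodic⇒fixed : ∀ {L Q} .{{_ : NonZero L}} {a : Vec (Fin m) n} →
    T^ L a ≡ a → EventuallyPeriodic a Q → T^ Q a ≡ a
  fixed∧eventuallyPeriodic⇒fixed {L = L} {Q = Q} {a = a} fixed (N , periodic) = begin
    T^ Q a               ≡⟨ cong (T^ Q) (T^-*-fixed fixed N) ⟨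
    T^ Q (T^ (N * L) a)  ≡⟨ T^-+ Q (N * L) a ⟨
    T^ (Q + N * L) a     ≡⟨ cong (λ k → T^ k a) (+-comm Q (N * L)) ⟩
    T^ (N * L + Q) a     ≡⟨ periodic (N * L) (m≤m*n N L) ⟩
    T^ (N * L) a         ≡⟨ T^-*-fixed fixed N ⟩
    a                    ∎
    where open ≡-Reasoning

module Modular (m : ℕ) .{{_ : NonZero m}} where

  infix 4 _≈_
  _≈_ : ℕ → ℕ → Set
  a ≈ b = a % m ≡ b % m

  +-cong : ∀ {a b c d} → a ≈ b → c ≈ d → a + c ≈ b + d
  +-cong {a} {b} {c} {d} a≈b c≈d = begin
    (a + c) % m              ≡⟨ %-distribˡ-+ a c m ⟩
    (a % m + c % m) % m      ≡⟨ cong₂ (λ x y → (x + y) % m) a≈b c≈d ⟩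
    (b % m + d % m) % m      ≡⟨ %-distribˡ-+ b d m ⟨
    (b + d) % m              ∎
    where open ≡-Reasoning

  *-cong : ∀ {a b c d} → a ≈ b → c ≈ d → a * c ≈ b * d
  *-cong {a} {b} {c} {d} a≈b c≈d = begin
    (a * c) % m              ≡⟨ %-distribˡ-* a c m ⟩
    (a % m * (c % m)) % m    ≡⟨ cong₂ (λ x y → (x * y) % m) a≈b c≈d ⟩
    (b % m * (d % m)) % m    ≡⟨ %-distribˡ-* b d m ⟨
    (b * d) % m              ∎
    where open ≡-Reasoning

  -- Adding c * (m ∸ 1) completes c to a multiple of m.
  +-cancelʳ : ∀ {a b} c → a + c ≈ b + c → a ≈ b
  +-cancelʳ {a} {b} c a+c≈b+c = begin
    a % m                     ≡⟨ [m+kn]%n≡m%n a c m ⟨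
    (a + c * m) % m           ≡⟨ cong (_% m) (complete a) ⟩
    (a + c + c * pred m) % m  ≡⟨ +-cong a+c≈b+c refl ⟩
    (b + c + c * pred m) % m  ≡⟨ cong (_% m) (complete b) ⟨
    (b + c * m) % m           ≡⟨ [m+kn]%n≡m%n b c m ⟩
    b % m                     ∎
    where
    open ≡-Reasoning
    regroup : ∀ x c q → x + c * suc q ≡ x + c + c * q
    regroup = solve-∀
    complete : ∀ x → x + c * m ≡ x + c + c * pred m
    complete x = trans (cong (λ t → x + c * t) (sym (suc-pred m))) (regroup x c (pred m))

  ≈0⇒∣ : ∀ {a} → a ≈ 0 → m ∣ a
  ≈0⇒∣ {a} a≈0 = m%n≡0⇒n∣m a m (trans a≈0 (m*n%n≡0 0 m))

  ∣⇒≈0 : ∀ {a} → m ∣ a → a ≈ 0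
  ∣⇒≈0 {a} m∣a = trans (n∣m⇒m%n≡0 a m m∣a) (sym (m*n%n≡0 0 m))

  ^-≈1 : ∀ {a} → a ≈ 1 → ∀ k → a ^ k ≈ 1
  ^-≈1 a≈1 zero    = refl
  ^-≈1 a≈1 (suc k) = *-cong a≈1 (^-≈1 a≈1 k)

  n≉n+k : ∀ {n k} → 0 < k → k < m → ¬ n ≈ n + k
  n≉n+k {n} {k} 0<k k<m n≈n+k = <⇒≢ 0<k (begin
    0       ≡⟨ m*n%n≡0 0 m ⟨
    0 % m   ≡⟨ +-cancelʳ n (trans n≈n+k (cong (_% m) (+-comm n k))) ⟩
    k % m   ≡⟨ m<n⇒m%n≡m k<m ⟩
    k       ∎)
    where open ≡-Reasoning

  difference-≈ : ∀ {x y a b d} → x + d ≈ a → y + d ≈ b → x + b ≈ y + a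
  difference-≈ {x} {y} {a} {b} {d} x+d≈a y+d≈b = begin
    (x + b) % m        ≡⟨ +-cong {x} refl y+d≈b ⟨
    (x + (y + d)) % m  ≡⟨ cong (_% m) (x∙yz≈y∙xz x y d) ⟩
    (y + (x + d)) % m  ≡⟨ +-cong {y} refl x+d≈a ⟩
    (y + a) % m        ∎
    where open ≡-Reasoning

  toℕ-mod : ∀ a → toℕ (a mod m) ≡ a % m
  toℕ-mod a = toℕ-fromℕ< (m%n<n a m)

  mod-toℕ : ∀ (x : Fin m) → toℕ x mod m ≡ x
  mod-toℕ x = toℕ-injective (trans (toℕ-mod (toℕ x)) (m<n⇒m%n≡m (toℕ<n x)))

  mod-cong : ∀ {a b} → a ≈ b → a mod m ≡ b mod m
  mod-cong {a} {b} a≈b = toℕ-injective (trans (toℕ-mod a) (trans a≈b (sym (toℕ-mod b))))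

  mod-injective : ∀ {a b} → a mod m ≡ b mod m → a ≈ b
  mod-injective {a} {b} eq = trans (sym (toℕ-mod a)) (trans (cong toℕ eq) (toℕ-mod b))

  mod-+ : ∀ a b → (a mod m) +ₘ (b mod m) ≡ (a + b) mod m
  mod-+ a b = mod-cong
    (trans (cong₂ (λ x y → (x + y) % m) (toℕ-mod a) (toℕ-mod b)) (sym (%-distribˡ-+ a b m)))

  reduce : Vec ℕ n → Vec (Fin m) n
  reduce = map (_mod m)

  T-reduce : ∀ (v : Vec ℕ n) → T (reduce v) ≡ reduce (Tℕ v)
  T-reduce = zipWith-rotate-map mod-+

  T^-reduce : ∀ k (v : Vec ℕ n) → T^ k (reduce v) ≡ reduce (Tℕ^ k v)
  T^-reduce zero    v = refl
  T^-reduce (suc k) v = trans (cong T (T^-reduce k v)) (T-reduce (Tℕ^ k v))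

  reduce-toℕ : ∀ (a : Vec (Fin m) n) → reduce (map toℕ a) ≡ a
  reduce-toℕ a = trans (sym (map-∘ (_mod m) toℕ a)) (trans (map-cong mod-toℕ a) (map-id a))

  reduce-shift : ∀ {d} → d ≈ 0 → (v : Vec ℕ n) → reduce (shift d v) ≡ reduce v
  reduce-shift {d = d} d≈0 v = trans (sym (map-∘ (_mod m) (_+ d) v)) (map-cong x+d≡x v)
    where
    x+d≡x : ∀ x → (x + d) mod m ≡ x mod m
    x+d≡x x = mod-cong (trans (+-cong {x} refl d≈0) (cong (_% m) (+-identityʳ x)))

  reduce-injective : ∀ {v w : Vec ℕ n} → reduce v ≡ reduce w → ∀ i → lookup v i ≈ lookup w i
  reduce-injective {v = v} {w} eq i = mod-injective (begin
    lookup v i mod m     ≡⟨ lookup-map i (_mod m) v ⟨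
    lookup (reduce v) i  ≡⟨ cong (λ u → lookup u i) eq ⟩
    lookup (reduce w) i  ≡⟨ lookup-map i (_mod m) w ⟩
    lookup w i mod m     ∎)
    where open ≡-Reasoning

  ∣⇒2^≈1 : ∀ {O Q} → IsOrderOf2 m O → O ∣ Q → 2 ^ Q ≈ 1
  ∣⇒2^≈1 {O} (_ , 2^O≈1 , _) (divides t refl) =
    trans (cong (λ e → 2 ^ e % m) (*-comm t O)) (trans (cong (_% m) (sym (^-*-assoc 2 O t))) (^-≈1 2^O≈1 t))

  order∣ : ∀ {O Q} → IsOrderOf2 m O → 2 ^ Q ≈ 1 → O ∣ Q
  order∣ {O} {Q} (O>0 , 2^O≈1 , least) 2^Q≈1 = m%n≡0⇒n∣m Q O (remainder≡0 r (m%n<n Q O) 2^r≈1)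
    where
    instance _ = >-nonZero O>0
    r t : ℕ
    r = Q % O
    t = Q / O
    remainder≡0 : ∀ r → r < O → 2 ^ r ≈ 1 → r ≡ 0
    remainder≡0 zero    _   _     = refl
    remainder≡0 (suc r) r<O 2^r≈1 = ⊥-elim (<⇒≱ r<O (least (suc r) z<s 2^r≈1))
    split : 2 ^ Q ≡ 2 ^ r * (2 ^ O) ^ t
    split = begin
      2 ^ Q                ≡⟨ cong (2 ^_) (m≡m%n+[m/n]*n Q O) ⟩
      2 ^ (r + t * O)      ≡⟨ ^-distribˡ-+-* 2 r (t * O) ⟩
      2 ^ r * 2 ^ (t * O)  ≡⟨ cong (λ e → 2 ^ r * 2 ^ e) (*-comm t O) ⟩
      2 ^ r * 2 ^ (O * t)  ≡⟨ cong (2 ^ r *_) (^-*-assoc 2 O t) ⟨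
      2 ^ r * (2 ^ O) ^ t  ∎
      where open ≡-Reasoning
    2^r≈1 : 2 ^ r ≈ 1
    2^r≈1 = begin
      2 ^ r % m                  ≡⟨ cong (_% m) (*-identityʳ (2 ^ r)) ⟨
      (2 ^ r * 1) % m            ≡⟨ *-cong {2 ^ r} refl (^-≈1 2^O≈1 t) ⟨
      (2 ^ r * (2 ^ O) ^ t) % m  ≡⟨ cong (_% m) split ⟨
      2 ^ Q % m                  ≡⟨ 2^Q≈1 ⟩
      1 % m                      ∎
      where open ≡-Reasoning

p∣q*m∧q∣m⇒p∣m : ∀ {p q m} → Prime p → p ∣ q * m → q ∣ m → p ∣ m
p∣q*m∧q∣m⇒p∣m {q = q} {m} isPrime p∣q*m q∣m with euclidsLemma q m isPrime p∣q*m
... | inj₁ p∣q = ∣-trans p∣q q∣m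
... | inj₂ p∣m = p∣m

lcm≢0 : ∀ m n .{{_ : NonZero m}} .{{_ : NonZero n}} → NonZero (lcm m n)
lcm≢0 m n = m*n≢0⇒n≢0 (gcd m n) {{subst NonZero (sym (gcd*lcm m n)) (m*n≢0 m n)}}

e₁ℕ : Vec ℕ 3
e₁ℕ = 1 ∷ 0 ∷ 0 ∷ []

module Period (p : ℕ) .{{_ : NonZero p}} (isPrime : Prime p) (O : ℕ) (order : IsOrderOf2 p O) where
  open Modular p

  L : ℕ
  L = lcm O 6

  instance
    L≢0 : NonZero L
    L≢0 = lcm≢0 O 6 {{>-nonZero (proj₁ order)}}

  jCoeff≈0 : ∀ k → 2 ^ (6 * k) ≈ 1 → jCoeff k ≈ 0
  jCoeff≈0 k 2^6k≈1 = ∣⇒≈0 (p∣q*m∧q∣m⇒p∣m isPrime (≈0⇒∣ 3c≈0) (3∣jCoeff k))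
    where
    3c≈0 : 3 * jCoeff k ≈ 0
    3c≈0 = +-cancelʳ 1 (trans (cong (_% p) (3*jCoeff+1≡2^6k k)) 2^6k≈1)

  T^6k≡id : ∀ k → 2 ^ (6 * k) ≈ 1 → (a : Vec (Fin p) 3) → T^ (6 * k) a ≡ a
  T^6k≡id k 2^6k≈1 a = begin
    T^ (6 * k) a                         ≡⟨ cong (T^ (6 * k)) (reduce-toℕ a) ⟨
    T^ (6 * k) (reduce v)                ≡⟨ T^-reduce (6 * k) v ⟩
    reduce (Tℕ^ (6 * k) v)               ≡⟨ cong reduce (Tℕ^6k k v) ⟩
    reduce (shift (jCoeff k * sum v) v)  ≡⟨ reduce-shift (*-cong (jCoeff≈0 k 2^6k≈1) refl) v ⟩
    reduce v                             ≡⟨ reduce-toℕ a ⟩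
    a                                    ∎
    where
    open ≡-Reasoning
    v = map toℕ a

  T^L≡id : (a : Vec (Fin p) 3) → T^ L a ≡ a
  T^L≡id a with n∣lcm[m,n] O 6
  ... | divides k L≡k*6 = subst (λ i → T^ i a ≡ a) (sym L≡6k) (T^6k≡id k 2^6k≈1 a)
    where
    L≡6k : L ≡ 6 * k
    L≡6k = trans L≡k*6 (*-comm k 6)
    2^6k≈1 : 2 ^ (6 * k) ≈ 1
    2^6k≈1 = subst (λ i → 2 ^ i ≈ 1) L≡6k (∣⇒2^≈1 order (m∣lcm[m,n] O 6))

  e₁ : Vec (Fin p) 3
  e₁ = reduce e₁ℕ

  module _ (2<p : 2 < p) where

    1<p : 1 < p
    1<p = <⇒≤ 2<p

    shifted-entries-≈ : ∀ {u d} (i j : Fin 3) → reduce (shift d u) ≡ e₁ →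
      lookup u i + lookup e₁ℕ j ≈ lookup u j + lookup e₁ℕ i
    shifted-entries-≈ {u} {d} i j eq = difference-≈ (entry i) (entry j)
      where
      entry : ∀ k → lookup u k + d ≈ lookup e₁ℕ k
      entry k = subst (_≈ lookup e₁ℕ k) (lookup-map k (_+ d) u) (reduce-injective eq k)

    -- Tℕ^ r e₁ℕ for r = 1, …, 5 is (1,0,1), (1,1,2), (2,3,3), (5,6,5), (11,11,10).
    shift-orbit-e₁ : ∀ r d → r < 6 → reduce (shift d (Tℕ^ r e₁ℕ)) ≡ e₁ → r ≡ 0 × d ≈ 0
    shift-orbit-e₁ 0 d _ eq = refl , reduce-injective eq (# 1)
    shift-orbit-e₁ 1 d _ eq = ⊥-elim (n≉n+k {0}  z<s 1<p (shifted-entries-≈ (# 1) (# 2) eq))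
    shift-orbit-e₁ 2 d _ eq = ⊥-elim (n≉n+k {1}  z<s 1<p (shifted-entries-≈ (# 0) (# 1) eq))
    shift-orbit-e₁ 3 d _ eq = ⊥-elim (n≉n+k {2}  z<s 2<p (shifted-entries-≈ (# 0) (# 1) eq))
    shift-orbit-e₁ 4 d _ eq = ⊥-elim (n≉n+k {5}  z<s 2<p (shifted-entries-≈ (# 0) (# 1) eq))
    shift-orbit-e₁ 5 d _ eq = ⊥-elim (n≉n+k {11} z<s 1<p (shifted-entries-≈ (# 0) (# 1) eq))
    shift-orbit-e₁ (suc (suc (suc (suc (suc (suc _)))))) _ (s≤s (s≤s (s≤s (s≤s (s≤s (s≤s ())))))) _

    T^-returns-e₁⇒L∣ : ∀ Q → T^ Q e₁ ≡ e₁ → L ∣ Q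
    T^-returns-e₁⇒L∣ Q returns = lcm-least (order∣ order 2^Q≈1) (divides q (trans Q≡6q (*-comm 6 q)))
      where
      open ≡-Reasoning
      r q d : ℕ
      r = Q % 6
      q = Q / 6
      d = 2 ^ r * (jCoeff q * 1)
      Q≡r+6q : Q ≡ r + 6 * q
      Q≡r+6q = trans (m≡m%n+[m/n]*n Q 6) (cong (r +_) (*-comm q 6))
      orbit : reduce (shift d (Tℕ^ r e₁ℕ)) ≡ e₁
      orbit = begin
        reduce (shift d (Tℕ^ r e₁ℕ))  ≡⟨ cong reduce (Tℕ^[r+6q] r q e₁ℕ) ⟨
        reduce (Tℕ^ (r + 6 * q) e₁ℕ)  ≡⟨ T^-reduce (r + 6 * q) e₁ℕ ⟨
        T^ (r + 6 * q) e₁             ≡⟨ cong (λ i → T^ i e₁) Q≡r+6q ⟨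
        T^ Q e₁                       ≡⟨ returns ⟩
        e₁                            ∎
      r≡0 : r ≡ 0
      r≡0 = proj₁ (shift-orbit-e₁ r d (m%n<n Q 6) orbit)
      d≈0 : d ≈ 0
      d≈0 = proj₂ (shift-orbit-e₁ r d (m%n<n Q 6) orbit)
      d≡jCoeff : d ≡ jCoeff q
      d≡jCoeff = begin
        2 ^ r * (jCoeff q * 1)  ≡⟨ cong (λ i → 2 ^ i * (jCoeff q * 1)) r≡0 ⟩
        1 * (jCoeff q * 1)      ≡⟨ *-identityˡ (jCoeff q * 1) ⟩
        jCoeff q * 1            ≡⟨ *-identityʳ (jCoeff q) ⟩
        jCoeff q                ∎
      Q≡6q : Q ≡ 6 * q
      Q≡6q = trans Q≡r+6q (cong (_+ 6 * q) r≡0)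
      2^Q≈1 : 2 ^ Q ≈ 1
      2^Q≈1 = begin
        2 ^ Q % p               ≡⟨ cong (λ i → 2 ^ i % p) Q≡6q ⟩
        2 ^ (6 * q) % p         ≡⟨ cong (_% p) (3*jCoeff+1≡2^6k q) ⟨
        (3 * jCoeff q + 1) % p  ≡⟨ +-cong (*-cong {3} refl (subst (_≈ 0) d≡jCoeff d≈0)) refl ⟩
        1 % p                   ∎

proposition7p3 : ∀ (p : ℕ) .{{_ : NonZero p}} → Prime p → 2 < p →
    ∀ O → IsOrderOf2 p O → IsPeriod p 3 (lcm O 6)
proposition7p3 p isPrime 2<p O order =
    (e₁ , >-nonZero⁻¹ L , fixed⇒eventuallyPeriodic (T^L≡id e₁) , least)
  , λ a Q (_ , _ , minimal) → minimal L (>-nonZero⁻¹ L) (fixed⇒eventuallyPeriodic (T^L≡id a))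
  where
  open Period p isPrime O order
  least : ∀ Q → 0 < Q → EventuallyPeriodic e₁ Q → L ≤ Q
  least Q 0<Q periodic =
    ∣⇒≤ {{>-nonZero 0<Q}}
      (T^-returns-e₁⇒L∣ 2<p Q (fixed∧eventuallyPeriodic⇒fixed {L = L} (T^L≡id e₁) periodic))
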